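{- Let $q$ be a prime power and consider $\mathrm{GL}(2,q)$ acting on the non-zero vectors of $\mathbb{F}_q^2$. Every maximal intersecting set of $\mathrm{GL}(2,q)$ (i.e. an intersecting set not properly contained in another intersecting set) is a maximum intersecting set (i.e. has the largest possible size among intersecting sets). In particular, there are no Hilton–Milner type intersecting sets in $\mathrm{GL}(2,q)$.
   Context: A subset $\mathcal{F}\subseteq\mathrm{GL}(2,q)$ is intersecting if for all $A,B\in\mathcal{F}$ there is a non-zero $v\in\mathbb{F}_q^2$ with $Av=Bv$. A Hilton–Milner type set is a maximal intersecting set that is not a maximum intersecting set. -}

module Defs where

open import Level using (0ℓ)
open import Algebra.Bundles using (CommutativeRing)
open import Data.Nat using (ℕ; _≤_)
open import Data.Product using (_×_; _,_; ∃)
open import Data.List using (List; length)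
open import Data.List.Relation.Unary.Any using (Any)
open import Data.List.Relation.Unary.AllPairs using (AllPairs)
open import Relation.Nullary using (¬_)
open import Relation.Binary using (Decidable)

-- Its order q = number of elements is a prime power, and every prime power
-- arises; quantifying over finite fields = quantifying over prime powers q.
record FiniteField : Set₁ where
  field
    commRing : CommutativeRing 0ℓ 0ℓ
  open CommutativeRing commRing public
  field
    0≉1      : ¬ (0# ≈ 1#)
    inverse  : ∀ x → ¬ (x ≈ 0#) → ∃ λ y → (x * y) ≈ 1#
    _≈?_     : Decidable _≈_
    elements : List Carrier
    complete : ∀ x → Any (x ≈_) elements

module GL (𝔽 : FiniteField) where
  open FiniteField 𝔽

  record Mat : Set where
    constructor mat
    field a b c d : Carrier

  Vec2 : Set
  Vec2 = Carrier × Carrier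

  NonZero : Vec2 → Set
  NonZero (x , y) = ¬ ((x ≈ 0#) × (y ≈ 0#))

  _·_ : Mat → Vec2 → Vec2
  mat a b c d · (x , y) = (a * x + b * y) , (c * x + d * y)

  _≈V_ : Vec2 → Vec2 → Set
  (x , y) ≈V (x' , y') = (x ≈ x') × (y ≈ y')

  _≈M_ : Mat → Mat → Set
  mat a b c d ≈M mat a' b' c' d' = (a ≈ a') × (b ≈ b') × (c ≈ c') × (d ≈ d')

  det : Mat → Carrier
  det (mat a b c d) = a * d - b * c

  Invertible : Mat → Set
  Invertible M = ¬ (det M ≈ 0#)

  -- finite subsets of GL(2,q) are represented by duplicate-free lists
  _∈_ : Mat → List Mat → Set
  M ∈ S = Any (M ≈M_) S

  _⊆_ : List Mat → List Mat → Set
  S ⊆ T = ∀ M → M ∈ S → M ∈ T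

  IsGLSubset : List Mat → Set
  IsGLSubset S = (∀ M → M ∈ S → Invertible M) × AllPairs (λ A B → ¬ (A ≈M B)) S

  size : List Mat → ℕ
  size = length

  Intersecting : List Mat → Set
  Intersecting S = ∀ A B → A ∈ S → B ∈ S → ∃ λ v → NonZero v × ((A · v) ≈V (B · v))

  MaximalIntersecting : List Mat → Set
  MaximalIntersecting S =
    Intersecting S × (∀ T → IsGLSubset T → Intersecting T → S ⊆ T → T ⊆ S)

  MaximumIntersecting : List Mat → Set
  MaximumIntersecting S =
    Intersecting S × (∀ T → IsGLSubset T → Intersecting T → size T ≤ size S)

{-# OPTIONS --safe #-}
-- Two matrices intersect exactly when their difference is singular. Fix A₀ in an intersecting
-- set T. Either all B ∈ T agree with A₀ on one nonzero vector k, so T lies in the coset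
-- {M | M k = A₀ k} of a vector stabiliser, or there are B₁, B₂ ∈ T and a basis k₁, k₂ with
-- B₁ k₁ = A₀ k₁, B₂ k₂ = A₀ k₂, B₁ ≠ A₀ and B₂ k₁ ≠ A₀ k₁. In the second case, because all
-- differences within T are singular, (B − A₀) k₁ and (B − A₀) k₂ lie on the line through
-- x = (B₂ − A₀) k₁ for every B ∈ T, so T lies in {M | Mᵀ x⊥ = A₀ᵀ x⊥}, a coset for the
-- transposed action. Any two such cosets correspond under M ↦ P M Q (up to transposition)
-- with P, Q invertible, which is injective and preserves invertibility. A maximal
-- intersecting set lies in a coset and therefore contains all of its invertible members, so
-- every intersecting set injects into it.
module Submission where

open import Algebra.Bundles using (CommutativeRing)
open import Data.Bool using (Bool; true; false)
open import Data.Empty using (⊥-elim)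
open import Data.Fin using (Fin; zero; suc)
open import Data.Fin.Properties using (injective⇒≤)
open import Data.Integer using (+_)
open import Data.List using (List; []; _∷_; [_]; length; lookup)
open import Data.List.Relation.Unary.Any as Any using (here; there)
open import Data.List.Relation.Unary.All as All using ([]; _∷_)
open import Data.List.Relation.Unary.All.Properties using (¬All⇒Any¬; ¬Any⇒All¬)
open import Data.List.Relation.Unary.AllPairs using ([]; _∷_)
open import Data.Nat using (_≤_; z≤n)
open import Data.Product using (Σ; ∃; _×_; _,_; proj₁; proj₂)
open import Data.Sum using (_⊎_; inj₁; inj₂)
open import Relation.Binary using (Setoid)
import Relation.Binary.Reasoning.Setoid
open import Relation.Binary.PropositionalEquality as ≡ using (_≡_)
open import Relation.Nullary using (¬_; Dec; yes; no)
open import Relation.Nullary.Decidable using (_×-dec_)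
open import Defs

-- The solver normalises polynomials by computing with their coefficients, so the coefficients
-- must be concrete: we take them in ℤ, which maps into every commutative ring.
module CommutativeRingSolver {c ℓ} (R : CommutativeRing c ℓ) where

  open import Data.Integer as ℤ using (ℤ; -[1+_]; _⊖_; ∣_∣; sign; _◃_)
  import Data.Integer.Properties as ℤ
  open import Data.Nat as ℕ using (zero; suc)
  import Data.Nat.Properties as ℕ
  open import Data.Sign as Sign using (Sign)
  open import Data.Maybe using (just; nothing)
  open import Algebra.Solver.Ring.AlmostCommutativeRing
    using (_-Raw-AlmostCommutative⟶_; fromCommutativeRing; Induced-equivalence)
  open import Relation.Binary.Definitions using (WeaklyDecidable)

  open CommutativeRing R
  open import Algebra.Properties.Ring ring using (-‿involutive; -0#≈0#; -1*x≈-x; -‿+-comm)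
  open import Algebra.Properties.CommutativeSemigroup +-commutativeSemigroup
    using (interchange)
  open import Algebra.Properties.CommutativeSemigroup *-commutativeSemigroup
    using () renaming (interchange to *-interchange)
  open import Algebra.Properties.Semiring.Mult.TCOptimised semiring
    using (×1-homo-*) renaming (_×_ to _×ₙ_)
  open import Algebra.Properties.Monoid.Mult.TCOptimised +-monoid using (×-homo-+)
  open import Relation.Binary.Reasoning.Setoid setoid

  private
    fromℤ : ℤ → Carrier
    fromℤ (+ n) = n ×ₙ 1#
    fromℤ -[1+ n ] = - (suc n ×ₙ 1#)

    x-0≈x : ∀ x → x - 0# ≈ x
    x-0≈x x = trans (+-congˡ -0#≈0#) (+-identityʳ x)

    ⊖-homo : ∀ m n → fromℤ (m ⊖ n) ≈ m ×ₙ 1# - n ×ₙ 1#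
    ⊖-homo zero zero = sym (x-0≈x 0#)
    ⊖-homo zero (suc n) = sym (+-identityˡ _)
    ⊖-homo (suc m) zero = sym (x-0≈x _)
    ⊖-homo (suc m) (suc n) = begin
      fromℤ (suc m ⊖ suc n)      ≡⟨ ≡.cong fromℤ (ℤ.[1+m]⊖[1+n]≡m⊖n m n) ⟩
      fromℤ (m ⊖ n)              ≈⟨ ⊖-homo m n ⟩
      M - N                      ≈⟨ +-identityˡ (M - N) ⟨
      0# + (M - N)               ≈⟨ +-congʳ (-‿inverseʳ 1#) ⟨
      (1# - 1#) + (M - N)        ≈⟨ interchange 1# (- 1#) M (- N) ⟩
      (1# + M) + (- 1# + - N)    ≈⟨ +-congˡ (-‿+-comm 1# N) ⟩
      (1# + M) - (1# + N)        ≈⟨ +-cong (1+× m) (-‿cong (1+× n)) ⟨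
      suc m ×ₙ 1# - suc n ×ₙ 1#  ∎
      where
      M N : Carrier
      M = m ×ₙ 1#
      N = n ×ₙ 1#
      1+× : ∀ k → suc k ×ₙ 1# ≈ 1# + k ×ₙ 1#
      1+× k = ×-homo-+ 1# 1 k

    +-homo : ∀ i j → fromℤ (i ℤ.+ j) ≈ fromℤ i + fromℤ j
    +-homo -[1+ m ] -[1+ n ] = begin
      - (suc (suc (m ℕ.+ n)) ×ₙ 1#)    ≡⟨ ≡.cong (λ k → - (suc k ×ₙ 1#)) (ℕ.+-suc m n) ⟨
      - ((suc m ℕ.+ suc n) ×ₙ 1#)      ≈⟨ -‿cong (×-homo-+ 1# (suc m) (suc n)) ⟩
      - (suc m ×ₙ 1# + suc n ×ₙ 1#)    ≈⟨ -‿+-comm _ _ ⟨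
      fromℤ -[1+ m ] + fromℤ -[1+ n ]  ∎
    +-homo -[1+ m ] (+ n) = trans (⊖-homo n (suc m)) (+-comm _ _)
    +-homo (+ m) -[1+ n ] = ⊖-homo m (suc n)
    +-homo (+ m) (+ n) = ×-homo-+ 1# m n

    fromSign : Sign → Carrier
    fromSign Sign.+ = 1#
    fromSign Sign.- = - 1#

    ◃-homo : ∀ s n → fromℤ (s ◃ n) ≈ fromSign s * (n ×ₙ 1#)
    ◃-homo s zero = sym (zeroʳ _)
    ◃-homo Sign.+ (suc n) = sym (*-identityˡ _)
    ◃-homo Sign.- (suc n) = sym (-1*x≈-x _)

    sign◃abs : ∀ i → fromℤ i ≈ fromSign (sign i) * (∣ i ∣ ×ₙ 1#)
    sign◃abs i = trans (reflexive (≡.cong fromℤ (≡.sym (ℤ.◃-inverse i)))) (◃-homo (sign i) ∣ i ∣)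

    sign-homo : ∀ s t → fromSign (s Sign.* t) ≈ fromSign s * fromSign t
    sign-homo Sign.- Sign.- = trans (sym (-‿involutive 1#)) (sym (-1*x≈-x _))
    sign-homo Sign.- Sign.+ = sym (*-identityʳ _)
    sign-homo Sign.+ t = sym (*-identityˡ _)

    *-homo : ∀ i j → fromℤ (i ℤ.* j) ≈ fromℤ i * fromℤ j
    *-homo i j = begin
      fromℤ ((sign i Sign.* sign j) ◃ (∣ i ∣ ℕ.* ∣ j ∣))
        ≈⟨ ◃-homo (sign i Sign.* sign j) (∣ i ∣ ℕ.* ∣ j ∣) ⟩
      fromSign (sign i Sign.* sign j) * ((∣ i ∣ ℕ.* ∣ j ∣) ×ₙ 1#)
        ≈⟨ *-cong (sign-homo (sign i) (sign j)) (×1-homo-* ∣ i ∣ ∣ j ∣) ⟩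
      (fromSign (sign i) * fromSign (sign j)) * ((∣ i ∣ ×ₙ 1#) * (∣ j ∣ ×ₙ 1#))
        ≈⟨ *-interchange _ _ _ _ ⟩
      (fromSign (sign i) * (∣ i ∣ ×ₙ 1#)) * (fromSign (sign j) * (∣ j ∣ ×ₙ 1#))
        ≈⟨ *-cong (sign◃abs i) (sign◃abs j) ⟨
      fromℤ i * fromℤ j ∎

    -‿homo : ∀ i → fromℤ (ℤ.- i) ≈ - fromℤ i
    -‿homo (+ zero) = sym -0#≈0#
    -‿homo (+ suc n) = refl
    -‿homo -[1+ n ] = sym (-‿involutive _)

    homomorphism : ℤ.+-*-rawRing -Raw-AlmostCommutative⟶ fromCommutativeRing R
    homomorphism = record
      { ⟦_⟧ = fromℤ ; +-homo = +-homo ; *-homo = *-homo ; -‿homo = -‿homo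
      ; 0-homo = refl ; 1-homo = refl
      }

    _≟_ : WeaklyDecidable (Induced-equivalence homomorphism)
    i ≟ j with i ℤ.≟ j
    ... | yes ≡.refl = just refl
    ... | no _ = nothing

  open import Algebra.Solver.Ring ℤ.+-*-rawRing (fromCommutativeRing R) homomorphism _≟_ public
    using (solve; _:=_; _:+_; _:*_; _:-_; :-_; con)

module _ {a b ℓ₁ ℓ₂} (S₁ : Setoid a ℓ₁) (S₂ : Setoid b ℓ₂) where

  open Setoid S₁ using (sym) renaming (Carrier to A; _≈_ to _≈₁_)
  open Setoid S₂ using () renaming (Carrier to B; _≈_ to _≈₂_)
  open import Data.List.Membership.Setoid S₁ using () renaming (_∈_ to _∈₁_)
  open import Data.List.Membership.Setoid S₂ using () renaming (_∈_ to _∈₂_)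
  open import Data.List.Membership.Setoid.Properties using (∈-lookup; index-injective)
  import Data.List.Membership.Propositional.Properties as Propositional
  open import Data.List.Relation.Unary.Unique.Setoid S₁ using (Unique)

  private
    lookup-injective : ∀ {xs} → Unique xs → ∀ i j → lookup xs i ≈₁ lookup xs j → i ≡ j
    lookup-injective (_ ∷ _) zero zero _ = ≡.refl
    lookup-injective {_ ∷ xs} (x≉ ∷ _) zero (suc j) x≈ =
      ⊥-elim (All.lookup x≉ (Propositional.∈-lookup {xs = xs} j) x≈)
    lookup-injective {_ ∷ xs} (x≉ ∷ _) (suc i) zero ≈x =
      ⊥-elim (All.lookup x≉ (Propositional.∈-lookup {xs = xs} i) (sym ≈x))
    lookup-injective (_ ∷ unique) (suc i) (suc j) eq = ≡.cong suc (lookup-injective unique i j eq)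

  length≤-by-injection : ∀ {xs ys} (f : A → B) → (∀ {x y} → f x ≈₂ f y → x ≈₁ y) →
    Unique xs → (∀ {x} → x ∈₁ xs → f x ∈₂ ys) → length xs ≤ length ys
  length≤-by-injection {xs} {ys} f f-injective xs-unique f-into =
    injective⇒≤ {f = position} position-injective
    where
    image∈ys : ∀ i → f (lookup xs i) ∈₂ ys
    image∈ys i = f-into (∈-lookup S₁ xs i)
    position : Fin (length xs) → Fin (length ys)
    position i = Any.index (image∈ys i)
    position-injective : ∀ {i j} → position i ≡ position j → i ≡ j
    position-injective {i} {j} eq =
      lookup-injective xs-unique i j (f-injective (index-injective S₂ (image∈ys i) (image∈ys j) eq))

module PlaneGeometry (𝔽 : FiniteField) where

  open FiniteField 𝔽
  open GL 𝔽
  open CommutativeRingSolver commRing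
  open import Algebra.Properties.Ring ring using (x∙y⁻¹≈ε⇒x≈y; x≈y⇒x∙y⁻¹≈ε; -0#≈0#; -‿involutive)
  module ≈-Reasoning = Relation.Binary.Reasoning.Setoid setoid

  -- Field arithmetic

  x*y≈0⇒y≈0 : ∀ {x y} → ¬ x ≈ 0# → x * y ≈ 0# → y ≈ 0#
  x*y≈0⇒y≈0 {x} {y} x≉0 xy≈0 with inverse x x≉0
  ... | x⁻¹ , xx⁻¹≈1 = begin
    y              ≈⟨ *-identityˡ y ⟨
    1# * y         ≈⟨ *-congʳ xx⁻¹≈1 ⟨
    (x * x⁻¹) * y  ≈⟨ solve 3 (λ x x⁻¹ y → (x :* x⁻¹) :* y := x⁻¹ :* (x :* y)) refl x x⁻¹ y ⟩
    x⁻¹ * (x * y)  ≈⟨ *-congˡ xy≈0 ⟩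
    x⁻¹ * 0#       ≈⟨ zeroʳ x⁻¹ ⟩
    0#             ∎
    where open ≈-Reasoning

  x*y≉0 : ∀ {x y} → ¬ x ≈ 0# → ¬ y ≈ 0# → ¬ x * y ≈ 0#
  x*y≉0 x≉0 y≉0 xy≈0 = y≉0 (x*y≈0⇒y≈0 x≉0 xy≈0)

  -x≈0⇒x≈0 : ∀ {x} → - x ≈ 0# → x ≈ 0#
  -x≈0⇒x≈0 {x} -x≈0 = trans (sym (-‿involutive x)) (trans (-‿cong -x≈0) -0#≈0#)

  x≈ay+bz⇒x≈0 : ∀ {x y z} a b → x ≈ a * y + b * z → y ≈ 0# → z ≈ 0# → x ≈ 0#
  x≈ay+bz⇒x≈0 {x} {y} {z} a b x≈ay+bz y≈0 z≈0 = begin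
    x                ≈⟨ x≈ay+bz ⟩
    a * y + b * z    ≈⟨ +-cong (*-congˡ y≈0) (*-congˡ z≈0) ⟩
    a * 0# + b * 0#  ≈⟨ +-cong (zeroʳ a) (zeroʳ b) ⟩
    0# + 0#          ≈⟨ +-identityʳ 0# ⟩
    0#               ∎
    where open ≈-Reasoning

  x≈y-z⇒x≈0 : ∀ {x y z} → x ≈ y - z → y ≈ 0# → z ≈ 0# → x ≈ 0#
  x≈y-z⇒x≈0 {x} {y} {z} x≈y-z y≈0 z≈0 = begin
    x        ≈⟨ x≈y-z ⟩
    y - z    ≈⟨ +-cong y≈0 (-‿cong z≈0) ⟩
    0# - 0#  ≈⟨ +-congˡ -0#≈0# ⟩
    0# + 0#  ≈⟨ +-identityʳ 0# ⟩
    0#       ∎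
    where open ≈-Reasoning

  t*u≈0⇒t≈0 : ∀ {t u₁ u₂} → NonZero (u₁ , u₂) → t * u₁ ≈ 0# → t * u₂ ≈ 0# → t ≈ 0#
  t*u≈0⇒t≈0 {t} u≢0 tu₁≈0 tu₂≈0 with t ≈? 0#
  ... | yes t≈0 = t≈0
  ... | no t≉0 = ⊥-elim (u≢0 (x*y≈0⇒y≈0 t≉0 tu₁≈0 , x*y≈0⇒y≈0 t≉0 tu₂≈0))

  -- The plane 𝔽²

  0ᵥ e₁ e₂ : Vec2
  0ᵥ = 0# , 0#
  e₁ = 1# , 0#
  e₂ = 0# , 1#

  infixl 6 _-ᵥ_
  _-ᵥ_ : Vec2 → Vec2 → Vec2
  (u₁ , u₂) -ᵥ (v₁ , v₂) = u₁ - v₁ , u₂ - v₂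

  ⟨_∣_⟩ : Vec2 → Vec2 → Carrier
  ⟨ u₁ , u₂ ∣ v₁ , v₂ ⟩ = u₁ * v₁ + u₂ * v₂

  infix 7 _∧_
  _∧_ : Vec2 → Vec2 → Carrier
  (u₁ , u₂) ∧ (v₁ , v₂) = u₁ * v₂ - u₂ * v₁

  infix 30 _⊥
  _⊥ : Vec2 → Vec2
  (u₁ , u₂) ⊥ = u₂ , - u₁

  infix 4 _∥_
  _∥_ : Vec2 → Vec2 → Set
  u ∥ v = u ∧ v ≈ 0#

  ≈V-setoid : Setoid _ _
  ≈V-setoid = record
    { Carrier = Vec2
    ; _≈_ = _≈V_
    ; isEquivalence = record
      { refl = refl , refl
      ; sym = λ (p , q) → sym p , sym q
      ; trans = λ (p , q) (p′ , q′) → trans p p′ , trans q q′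
      }
    }

  module ≈V = Setoid ≈V-setoid
  module ≈V-Reasoning = Relation.Binary.Reasoning.Setoid ≈V-setoid

  _≈V?_ : ∀ u v → Dec (u ≈V v)
  (u₁ , u₂) ≈V? (v₁ , v₂) = (u₁ ≈? v₁) ×-dec (u₂ ≈? v₂)

  e₁≢0 : NonZero e₁
  e₁≢0 (1≈0 , _) = 0≉1 (sym 1≈0)

  ≈V⇒-ᵥ≈0 : ∀ {u v} → u ≈V v → (u -ᵥ v) ≈V 0ᵥ
  ≈V⇒-ᵥ≈0 (p , q) = x≈y⇒x∙y⁻¹≈ε p , x≈y⇒x∙y⁻¹≈ε q

  -ᵥ≈0⇒≈V : ∀ {u v} → (u -ᵥ v) ≈V 0ᵥ → u ≈V v
  -ᵥ≈0⇒≈V (p , q) = x∙y⁻¹≈ε⇒x≈y _ _ p , x∙y⁻¹≈ε⇒x≈y _ _ q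

  -ᵥ-identityʳ : ∀ {u v} → v ≈V 0ᵥ → (u -ᵥ v) ≈V u
  -ᵥ-identityʳ (p , q) = x-y≈x p , x-y≈x q
    where
    x-y≈x : ∀ {x y} → y ≈ 0# → x - y ≈ x
    x-y≈x y≈0 = trans (+-congˡ (trans (-‿cong y≈0) -0#≈0#)) (+-identityʳ _)

  -ᵥ-cancelʳ : ∀ u v w → ((u -ᵥ w) -ᵥ (v -ᵥ w)) ≈V (u -ᵥ v)
  -ᵥ-cancelʳ (u₁ , u₂) (v₁ , v₂) (w₁ , w₂) = cancel u₁ v₁ w₁ , cancel u₂ v₂ w₂
    where
    cancel : ∀ x y z → (x - z) - (y - z) ≈ x - y
    cancel = solve 3 (λ x y z → (x :- z) :- (y :- z) := x :- y) refl

  ⊥-NonZero : ∀ {u} → NonZero u → NonZero (u ⊥)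
  ⊥-NonZero u≢0 (u₂≈0 , -u₁≈0) = u≢0 (-x≈0⇒x≈0 -u₁≈0 , u₂≈0)

  ∧-cong : ∀ {u u′ v v′} → u ≈V u′ → v ≈V v′ → u ∧ v ≈ u′ ∧ v′
  ∧-cong (p₁ , p₂) (q₁ , q₂) = +-cong (*-cong p₁ q₂) (-‿cong (*-cong p₂ q₁))

  ∥-resp : ∀ {u u′ v v′} → u ≈V u′ → v ≈V v′ → u ∥ v → u′ ∥ v′
  ∥-resp u≈u′ v≈v′ u∥v = trans (sym (∧-cong u≈u′ v≈v′)) u∥v

  ⟨∣⊥⟩≈∧ : ∀ u v → ⟨ u ∣ v ⊥ ⟩ ≈ u ∧ v
  ⟨∣⊥⟩≈∧ (u₁ , u₂) (v₁ , v₂) =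
    solve 4 (λ u₁ u₂ v₁ v₂ → u₁ :* v₂ :+ u₂ :* (:- v₁) := u₁ :* v₂ :- u₂ :* v₁) refl u₁ u₂ v₁ v₂

  ∥-refl : ∀ u → u ∥ u
  ∥-refl (u₁ , u₂) = solve 2 (λ u₁ u₂ → u₁ :* u₂ :- u₂ :* u₁ := con (+ 0)) refl u₁ u₂

  ⟨∣⊥⟩≈0 : ∀ u → ⟨ u ∣ u ⊥ ⟩ ≈ 0#
  ⟨∣⊥⟩≈0 u = trans (⟨∣⊥⟩≈∧ u u) (∥-refl u)

  ∥-sym : ∀ {u v} → u ∥ v → v ∥ u
  ∥-sym {u@(u₁ , u₂)} {v@(v₁ , v₂)} u∥v = -x≈0⇒x≈0 (trans (sym antisym) u∥v)
    where
    antisym : u ∧ v ≈ - (v ∧ u)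
    antisym = solve 4 (λ u₁ u₂ v₁ v₂ → u₁ :* v₂ :- u₂ :* v₁ := :- (v₁ :* u₂ :- v₂ :* u₁))
      refl u₁ u₂ v₁ v₂

  ≈0⇒∥ : ∀ {u} v → u ≈V 0ᵥ → u ∥ v
  ≈0⇒∥ {u₁ , u₂} (v₁ , v₂) (u₁≈0 , u₂≈0) = x≈ay+bz⇒x≈0 v₂ (- v₁)
    (solve 4 (λ u₁ u₂ v₁ v₂ → u₁ :* v₂ :- u₂ :* v₁ := v₂ :* u₁ :+ (:- v₁) :* u₂) refl u₁ u₂ v₁ v₂)
    u₁≈0 u₂≈0

  ∥-trans : ∀ {u v w} → NonZero v → v ∥ u → v ∥ w → u ∥ w
  ∥-trans {u@(u₁ , u₂)} {v@(v₁ , v₂)} {w@(w₁ , w₂)} v≢0 v∥u v∥w = t*u≈0⇒t≈0 v≢0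
    (x≈ay+bz⇒x≈0 u₁ (- w₁) by-v₁ v∥w v∥u)
    (x≈ay+bz⇒x≈0 u₂ (- w₂) by-v₂ v∥w v∥u)
    where
    by-v₁ : (u ∧ w) * v₁ ≈ u₁ * (v ∧ w) + (- w₁) * (v ∧ u)
    by-v₁ = solve 6 (λ u₁ u₂ v₁ v₂ w₁ w₂ → (u₁ :* w₂ :- u₂ :* w₁) :* v₁
      := u₁ :* (v₁ :* w₂ :- v₂ :* w₁) :+ (:- w₁) :* (v₁ :* u₂ :- v₂ :* u₁)) refl u₁ u₂ v₁ v₂ w₁ w₂
    by-v₂ : (u ∧ w) * v₂ ≈ u₂ * (v ∧ w) + (- w₂) * (v ∧ u)
    by-v₂ = solve 6 (λ u₁ u₂ v₁ v₂ w₁ w₂ → (u₁ :* w₂ :- u₂ :* w₁) :* v₂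
      := u₂ :* (v₁ :* w₂ :- v₂ :* w₁) :+ (:- w₂) :* (v₁ :* u₂ :- v₂ :* u₁)) refl u₁ u₂ v₁ v₂ w₁ w₂

  ∥-subʳ : ∀ {u v w} → u ∥ v → u ∥ (v -ᵥ w) → u ∥ w
  ∥-subʳ {u₁ , u₂} {v₁ , v₂} {w₁ , w₂} = x≈y-z⇒x≈0 (solve 6 (λ u₁ u₂ v₁ v₂ w₁ w₂ →
    u₁ :* w₂ :- u₂ :* w₁ := (u₁ :* v₂ :- u₂ :* v₁) :- (u₁ :* (v₂ :- w₂) :- u₂ :* (v₁ :- w₁))) refl
    u₁ u₂ v₁ v₂ w₁ w₂)

  ∥-subˡ : ∀ {u v w} → u ∥ w → (u -ᵥ v) ∥ w → v ∥ w
  ∥-subˡ {u₁ , u₂} {v₁ , v₂} {w₁ , w₂} = x≈y-z⇒x≈0 (solve 6 (λ u₁ u₂ v₁ v₂ w₁ w₂ →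
    v₁ :* w₂ :- v₂ :* w₁ := (u₁ :* w₂ :- u₂ :* w₁) :- ((u₁ :- v₁) :* w₂ :- (u₂ :- v₂) :* w₁)) refl
    u₁ u₂ v₁ v₂ w₁ w₂)

  common-⟂⇒∥ : ∀ {r s w} → NonZero w → ⟨ r ∣ w ⟩ ≈ 0# → ⟨ s ∣ w ⟩ ≈ 0# → r ∥ s
  common-⟂⇒∥ {r@(r₁ , r₂)} {s@(s₁ , s₂)} {w@(w₁ , w₂)} w≢0 r⟂w s⟂w = t*u≈0⇒t≈0 w≢0
    (x≈ay+bz⇒x≈0 s₂ (- r₂) by-w₁ r⟂w s⟂w)
    (x≈ay+bz⇒x≈0 (- s₁) r₁ by-w₂ r⟂w s⟂w)
    where
    by-w₁ : (r ∧ s) * w₁ ≈ s₂ * ⟨ r ∣ w ⟩ + (- r₂) * ⟨ s ∣ w ⟩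
    by-w₁ = solve 6 (λ r₁ r₂ s₁ s₂ w₁ w₂ → (r₁ :* s₂ :- r₂ :* s₁) :* w₁
      := s₂ :* (r₁ :* w₁ :+ r₂ :* w₂) :+ (:- r₂) :* (s₁ :* w₁ :+ s₂ :* w₂)) refl r₁ r₂ s₁ s₂ w₁ w₂
    by-w₂ : (r ∧ s) * w₂ ≈ (- s₁) * ⟨ r ∣ w ⟩ + r₁ * ⟨ s ∣ w ⟩
    by-w₂ = solve 6 (λ r₁ r₂ s₁ s₂ w₁ w₂ → (r₁ :* s₂ :- r₂ :* s₁) :* w₂
      := (:- s₁) :* (r₁ :* w₁ :+ r₂ :* w₂) :+ r₁ :* (s₁ :* w₁ :+ s₂ :* w₂)) refl r₁ r₂ s₁ s₂ w₁ w₂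

  ∥⇒common-⟂ : ∀ {r s} → r ∥ s → ∃ λ w → NonZero w × ⟨ r ∣ w ⟩ ≈ 0# × ⟨ s ∣ w ⟩ ≈ 0#
  ∥⇒common-⟂ {r} {s} r∥s with r ≈V? 0ᵥ | s ≈V? 0ᵥ
  ... | no r≢0 | _ = r ⊥ , ⊥-NonZero r≢0 , ⟨∣⊥⟩≈0 r , trans (⟨∣⊥⟩≈∧ s r) (∥-sym r∥s)
  ... | yes r≈0 | no s≢0 = s ⊥ , ⊥-NonZero s≢0 , trans (⟨∣⊥⟩≈∧ r s) r∥s , ⟨∣⊥⟩≈0 s
  ... | yes r≈0 | yes s≈0 = e₁ , e₁≢0 , ≈0⇒⟂e₁ r≈0 , ≈0⇒⟂e₁ s≈0
    where
    ≈0⇒⟂e₁ : ∀ {u} → u ≈V 0ᵥ → ⟨ u ∣ e₁ ⟩ ≈ 0#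
    ≈0⇒⟂e₁ {u₁ , u₂} (u₁≈0 , u₂≈0) =
      x≈ay+bz⇒x≈0 1# 0# (+-cong (*-comm u₁ 1#) (*-comm u₂ 0#)) u₁≈0 u₂≈0

  ⟂-basis⇒≈0 : ∀ {r k l} → ¬ k ∥ l → ⟨ r ∣ k ⟩ ≈ 0# → ⟨ r ∣ l ⟩ ≈ 0# → r ≈V 0ᵥ
  ⟂-basis⇒≈0 {r@(r₁ , r₂)} {k@(k₁ , k₂)} {l@(l₁ , l₂)} k∦l r⟂k r⟂l =
    x*y≈0⇒y≈0 k∦l (x≈ay+bz⇒x≈0 l₂ (- k₂) by-r₁ r⟂k r⟂l) ,
    x*y≈0⇒y≈0 k∦l (x≈ay+bz⇒x≈0 (- l₁) k₁ by-r₂ r⟂k r⟂l)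
    where
    by-r₁ : (k ∧ l) * r₁ ≈ l₂ * ⟨ r ∣ k ⟩ + (- k₂) * ⟨ r ∣ l ⟩
    by-r₁ = solve 6 (λ r₁ r₂ k₁ k₂ l₁ l₂ → (k₁ :* l₂ :- k₂ :* l₁) :* r₁
      := l₂ :* (r₁ :* k₁ :+ r₂ :* k₂) :+ (:- k₂) :* (r₁ :* l₁ :+ r₂ :* l₂)) refl r₁ r₂ k₁ k₂ l₁ l₂
    by-r₂ : (k ∧ l) * r₂ ≈ (- l₁) * ⟨ r ∣ k ⟩ + k₁ * ⟨ r ∣ l ⟩
    by-r₂ = solve 6 (λ r₁ r₂ k₁ k₂ l₁ l₂ → (k₁ :* l₂ :- k₂ :* l₁) :* r₂
      := (:- l₁) :* (r₁ :* k₁ :+ r₂ :* k₂) :+ k₁ :* (r₁ :* l₁ :+ r₂ :* l₂)) refl r₁ r₂ k₁ k₂ l₁ l₂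

  ⟂-resp-∥ : ∀ {r k l} → NonZero l → k ∥ l → ⟨ r ∣ l ⟩ ≈ 0# → ⟨ r ∣ k ⟩ ≈ 0#
  ⟂-resp-∥ {r@(r₁ , r₂)} {k@(k₁ , k₂)} {l@(l₁ , l₂)} l≢0 k∥l r⟂l = t*u≈0⇒t≈0 l≢0
    (x≈ay+bz⇒x≈0 k₁ (- r₂) by-l₁ r⟂l k∥l)
    (x≈ay+bz⇒x≈0 k₂ r₁ by-l₂ r⟂l k∥l)
    where
    by-l₁ : ⟨ r ∣ k ⟩ * l₁ ≈ k₁ * ⟨ r ∣ l ⟩ + (- r₂) * (k ∧ l)
    by-l₁ = solve 6 (λ r₁ r₂ k₁ k₂ l₁ l₂ → (r₁ :* k₁ :+ r₂ :* k₂) :* l₁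
      := k₁ :* (r₁ :* l₁ :+ r₂ :* l₂) :+ (:- r₂) :* (k₁ :* l₂ :- k₂ :* l₁)) refl r₁ r₂ k₁ k₂ l₁ l₂
    by-l₂ : ⟨ r ∣ k ⟩ * l₂ ≈ k₂ * ⟨ r ∣ l ⟩ + r₁ * (k ∧ l)
    by-l₂ = solve 6 (λ r₁ r₂ k₁ k₂ l₁ l₂ → (r₁ :* k₁ :+ r₂ :* k₂) :* l₂
      := k₂ :* (r₁ :* l₁ :+ r₂ :* l₂) :+ r₁ :* (k₁ :* l₂ :- k₂ :* l₁)) refl r₁ r₂ k₁ k₂ l₁ l₂

  e₁∧e₂≈1 : e₁ ∧ e₂ ≈ 1#
  e₁∧e₂≈1 = solve 0 (con (+ 1) :* con (+ 1) :- con (+ 0) :* con (+ 0) := con (+ 1)) refl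

  e₁∦e₂ : ¬ e₁ ∥ e₂
  e₁∦e₂ e₁∥e₂ = 0≉1 (trans (sym e₁∥e₂) e₁∧e₂≈1)

  -- 2 × 2 matrices

  infixl 6 _-ₘ_
  _-ₘ_ : Mat → Mat → Mat
  mat a b c d -ₘ mat a′ b′ c′ d′ = mat (a - a′) (b - b′) (c - c′) (d - d′)

  infixl 7 _*ₘ_
  _*ₘ_ : Mat → Mat → Mat
  mat a b c d *ₘ mat a′ b′ c′ d′ =
    mat (a * a′ + b * c′) (a * b′ + b * d′) (c * a′ + d * c′) (c * b′ + d * d′)

  infix 30 _ᵀ
  _ᵀ : Mat → Mat
  mat a b c d ᵀ = mat a c b d

  adj : Mat → Mat
  adj (mat a b c d) = mat d (- b) (- c) a

  ≈M-setoid : Setoid _ _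
  ≈M-setoid = record
    { Carrier = Mat
    ; _≈_ = _≈M_
    ; isEquivalence = record
      { refl = refl , refl , refl , refl
      ; sym = λ (p , q , r , s) → sym p , sym q , sym r , sym s
      ; trans = λ (p , q , r , s) (p′ , q′ , r′ , s′) → trans p p′ , trans q q′ , trans r r′ , trans s s′
      }
    }

  module ≈M = Setoid ≈M-setoid

  _≈M?_ : ∀ A B → Dec (A ≈M B)
  mat a b c d ≈M? mat a′ b′ c′ d′ = (a ≈? a′) ×-dec (b ≈? b′) ×-dec (c ≈? c′) ×-dec (d ≈? d′)

  ·-cong : ∀ {A B u v} → A ≈M B → u ≈V v → (A · u) ≈V (B · v)
  ·-cong (p , q , r , s) (x , y) = +-cong (*-cong p x) (*-cong q y) , +-cong (*-cong r x) (*-cong s y)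

  det-cong : ∀ {A B} → A ≈M B → det A ≈ det B
  det-cong (p , q , r , s) = +-cong (*-cong p s) (-‿cong (*-cong q r))

  ·e₁ : ∀ a b c d → (mat a b c d · e₁) ≈V (a , c)
  ·e₁ a b c d = entry a b , entry c d
    where
    entry : ∀ x y → x * 1# + y * 0# ≈ x
    entry = solve 2 (λ x y → x :* con (+ 1) :+ y :* con (+ 0) := x) refl

  -ₘ-· : ∀ A B v → ((A -ₘ B) · v) ≈V ((A · v) -ᵥ (B · v))
  -ₘ-· (mat a b c d) (mat a′ b′ c′ d′) (x , y) = row a b a′ b′ , row c d c′ d′
    where
    row : ∀ a b a′ b′ → (a - a′) * x + (b - b′) * y ≈ (a * x + b * y) - (a′ * x + b′ * y)
    row a b a′ b′ = solve 6 (λ a b a′ b′ x y →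
      (a :- a′) :* x :+ (b :- b′) :* y := (a :* x :+ b :* y) :- (a′ :* x :+ b′ :* y)) refl a b a′ b′ x y

  ·-distrib-ᵥ : ∀ M u v → (M · (u -ᵥ v)) ≈V ((M · u) -ᵥ (M · v))
  ·-distrib-ᵥ (mat a b c d) (x , y) (x′ , y′) = row a b , row c d
    where
    row : ∀ a b → a * (x - x′) + b * (y - y′) ≈ (a * x + b * y) - (a * x′ + b * y′)
    row a b = solve 6 (λ a b x y x′ y′ →
      a :* (x :- x′) :+ b :* (y :- y′) := (a :* x :+ b :* y) :- (a :* x′ :+ b :* y′)) refl a b x y x′ y′

  *ₘ-· : ∀ A B v → ((A *ₘ B) · v) ≈V (A · (B · v))
  *ₘ-· (mat a b c d) (mat a′ b′ c′ d′) (x , y) = row a b , row c d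
    where
    row : ∀ a b → (a * a′ + b * c′) * x + (a * b′ + b * d′) * y ≈ a * (a′ * x + b′ * y) + b * (c′ * x + d′ * y)
    row a b = solve 8 (λ a b a′ b′ c′ d′ x y →
      (a :* a′ :+ b :* c′) :* x :+ (a :* b′ :+ b :* d′) :* y
      := a :* (a′ :* x :+ b′ :* y) :+ b :* (c′ :* x :+ d′ :* y)) refl a b a′ b′ c′ d′ x y

  det-*ₘ : ∀ A B → det (A *ₘ B) ≈ det A * det B
  det-*ₘ (mat a b c d) (mat a′ b′ c′ d′) = solve 8 (λ a b c d a′ b′ c′ d′ →
    (a :* a′ :+ b :* c′) :* (c :* b′ :+ d :* d′) :- (a :* b′ :+ b :* d′) :* (c :* a′ :+ d :* c′)
    := (a :* d :- b :* c) :* (a′ :* d′ :- b′ :* c′)) refl a b c d a′ b′ c′ d′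

  det-ᵀ : ∀ M → det (M ᵀ) ≈ det M
  det-ᵀ (mat a b c d) = solve 4 (λ a b c d → a :* d :- c :* b := a :* d :- b :* c) refl a b c d

  det-adj : ∀ M → det (adj M) ≈ det M
  det-adj (mat a b c d) =
    solve 4 (λ a b c d → d :* a :- (:- b) :* (:- c) := a :* d :- b :* c) refl a b c d

  adj-· : ∀ M v → det M ≈ 1# → (adj M · (M · v)) ≈V v
  adj-· M@(mat a b c d) (x , y) det≈1 =
    trans first (trans (*-congʳ det≈1) (*-identityˡ x)) ,
    trans second (trans (*-congʳ det≈1) (*-identityˡ y))
    where
    first : d * (a * x + b * y) + (- b) * (c * x + d * y) ≈ det M * x
    first = solve 6 (λ a b c d x y →
      d :* (a :* x :+ b :* y) :+ (:- b) :* (c :* x :+ d :* y) := (a :* d :- b :* c) :* x) refl a b c d x y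
    second : (- c) * (a * x + b * y) + a * (c * x + d * y) ≈ det M * y
    second = solve 6 (λ a b c d x y →
      (:- c) :* (a :* x :+ b :* y) :+ a :* (c :* x :+ d :* y) := (a :* d :- b :* c) :* y) refl a b c d x y

  det-∧ : ∀ M k l → (M · k) ∧ (M · l) ≈ det M * (k ∧ l)
  det-∧ (mat a b c d) (k₁ , k₂) (l₁ , l₂) = solve 8 (λ a b c d k₁ k₂ l₁ l₂ →
    (a :* k₁ :+ b :* k₂) :* (c :* l₁ :+ d :* l₂) :- (c :* k₁ :+ d :* k₂) :* (a :* l₁ :+ b :* l₂)
    := (a :* d :- b :* c) :* (k₁ :* l₂ :- k₂ :* l₁)) refl a b c d k₁ k₂ l₁ l₂

  ⟨ᵀ·⊥∣⟩≈·∧ : ∀ M x k → ⟨ M ᵀ · x ⊥ ∣ k ⟩ ≈ (M · k) ∧ x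
  ⟨ᵀ·⊥∣⟩≈·∧ (mat a b c d) (x₁ , x₂) (k₁ , k₂) = solve 8 (λ a b c d x₁ x₂ k₁ k₂ →
    (a :* x₂ :+ c :* (:- x₁)) :* k₁ :+ (b :* x₂ :+ d :* (:- x₁)) :* k₂
    := (a :* k₁ :+ b :* k₂) :* x₂ :- (c :* k₁ :+ d :* k₂) :* x₁) refl a b c d x₁ x₂ k₁ k₂

  kernel⇒singular : ∀ {M w} → NonZero w → (M · w) ≈V 0ᵥ → det M ≈ 0#
  kernel⇒singular {mat a b c d} w≢0 (row₁⟂w , row₂⟂w) = common-⟂⇒∥ w≢0 row₁⟂w row₂⟂w

  singular⇒kernel : ∀ {M} → det M ≈ 0# → ∃ λ w → NonZero w × (M · w) ≈V 0ᵥ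
  singular⇒kernel {mat a b c d} rows∥ =
    let w , w≢0 , row₁⟂w , row₂⟂w = ∥⇒common-⟂ rows∥ in w , w≢0 , row₁⟂w , row₂⟂w

  agree⇒-ₘ-kernel : ∀ {A B v} → (A · v) ≈V (B · v) → ((A -ₘ B) · v) ≈V 0ᵥ
  agree⇒-ₘ-kernel {A} {B} {v} Av≈Bv = ≈V.trans (-ₘ-· A B v) (≈V⇒-ᵥ≈0 Av≈Bv)

  -ₘ-kernel⇒agree : ∀ {A B v} → ((A -ₘ B) · v) ≈V 0ᵥ → (A · v) ≈V (B · v)
  -ₘ-kernel⇒agree {A} {B} {v} [A-B]v≈0 = -ᵥ≈0⇒≈V (≈V.trans (≈V.sym (-ₘ-· A B v)) [A-B]v≈0)

  agree⇒singular-difference : ∀ {A B w} → NonZero w → (A · w) ≈V (B · w) → det (A -ₘ B) ≈ 0#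
  agree⇒singular-difference w≢0 Aw≈Bw = kernel⇒singular w≢0 (agree⇒-ₘ-kernel Aw≈Bw)

  singular-difference⇒agree : ∀ {A B} → det (A -ₘ B) ≈ 0# → ∃ λ w → NonZero w × (A · w) ≈V (B · w)
  singular-difference⇒agree det≈0 =
    let w , w≢0 , [A-B]w≈0 = singular⇒kernel det≈0 in w , w≢0 , -ₘ-kernel⇒agree [A-B]w≈0

  agree-on-basis⇒≈M : ∀ {A B k l} → ¬ k ∥ l → (A · k) ≈V (B · k) → (A · l) ≈V (B · l) → A ≈M B
  agree-on-basis⇒≈M {A@(mat a b c d)} {B@(mat a′ b′ c′ d′)} {k} {l} k∦l Ak≈Bk Al≈Bl =
    x∙y⁻¹≈ε⇒x≈y a a′ (proj₁ row₁≈0) , x∙y⁻¹≈ε⇒x≈y b b′ (proj₂ row₁≈0) ,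
    x∙y⁻¹≈ε⇒x≈y c c′ (proj₁ row₂≈0) , x∙y⁻¹≈ε⇒x≈y d d′ (proj₂ row₂≈0)
    where
    [A-B]k≈0 : ((A -ₘ B) · k) ≈V 0ᵥ
    [A-B]k≈0 = agree⇒-ₘ-kernel Ak≈Bk
    [A-B]l≈0 : ((A -ₘ B) · l) ≈V 0ᵥ
    [A-B]l≈0 = agree⇒-ₘ-kernel Al≈Bl
    row₁≈0 : (a - a′ , b - b′) ≈V 0ᵥ
    row₁≈0 = ⟂-basis⇒≈0 k∦l (proj₁ [A-B]k≈0) (proj₁ [A-B]l≈0)
    row₂≈0 : (c - c′ , d - d′) ≈V 0ᵥ
    row₂≈0 = ⟂-basis⇒≈0 k∦l (proj₂ [A-B]k≈0) (proj₂ [A-B]l≈0)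

  agree-on-∥ : ∀ {A B k l} → NonZero l → k ∥ l → (A · l) ≈V (B · l) → (A · k) ≈V (B · k)
  agree-on-∥ {A@(mat a b c d)} {B@(mat a′ b′ c′ d′)} {k} {l} l≢0 k∥l Al≈Bl =
    -ₘ-kernel⇒agree (⟂-resp-∥ l≢0 k∥l (proj₁ [A-B]l≈0) , ⟂-resp-∥ l≢0 k∥l (proj₂ [A-B]l≈0))
    where
    [A-B]l≈0 : ((A -ₘ B) · l) ≈V 0ᵥ
    [A-B]l≈0 = agree⇒-ₘ-kernel Al≈Bl

  det≈1⇒Invertible : ∀ {M} → det M ≈ 1# → Invertible M
  det≈1⇒Invertible det≈1 det≈0 = 0≉1 (trans (sym det≈0) det≈1)

  Invertible-resp : ∀ {A B} → A ≈M B → Invertible B → Invertible A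
  Invertible-resp A≈B B-inv det≈0 = B-inv (trans (sym (det-cong A≈B)) det≈0)

  Invertible-ᵀ : ∀ {M} → Invertible M → Invertible (M ᵀ)
  Invertible-ᵀ {M} M-inv det≈0 = M-inv (trans (sym (det-ᵀ M)) det≈0)

  Invertible⇒NonZero : ∀ {M v} → Invertible M → NonZero v → NonZero (M · v)
  Invertible⇒NonZero M-inv v≢0 Mv≈0 = M-inv (kernel⇒singular v≢0 Mv≈0)

  Invertible-injective : ∀ {M u v} → Invertible M → (M · u) ≈V (M · v) → u ≈V v
  Invertible-injective {M} {u} {v} M-inv Mu≈Mv with (u -ᵥ v) ≈V? 0ᵥ
  ... | yes u-v≈0 = -ᵥ≈0⇒≈V u-v≈0
  ... | no u-v≢0 = ⊥-elim (M-inv (kernel⇒singular u-v≢0 M[u-v]≈0))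
    where
    M[u-v]≈0 : (M · (u -ᵥ v)) ≈V 0ᵥ
    M[u-v]≈0 = ≈V.trans (·-distrib-ᵥ M u v) (≈V⇒-ᵥ≈0 Mu≈Mv)

  Invertible-∦ : ∀ {M k l} → Invertible M → ¬ k ∥ l → ¬ (M · k) ∥ (M · l)
  Invertible-∦ {M} {k} {l} M-inv k∦l Mk∥Ml = x*y≉0 M-inv k∦l (trans (sym (det-∧ M k l)) Mk∥Ml)

  SL-completion : ∀ {v} → NonZero v → Σ Mat λ B → det B ≈ 1# × (B · e₁) ≈V v
  SL-completion {v₁ , v₂} v≢0 with v₁ ≈? 0#
  ... | no v₁≉0 =
    let v₁⁻¹ , v₁v₁⁻¹≈1 = inverse v₁ v₁≉0
        det≈ : v₁ * v₁⁻¹ - 0# * v₂ ≈ v₁ * v₁⁻¹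
        det≈ = solve 3 (λ v₁ v₂ i → v₁ :* i :- con (+ 0) :* v₂ := v₁ :* i) refl v₁ v₂ v₁⁻¹
    in mat v₁ 0# v₂ v₁⁻¹ , trans det≈ v₁v₁⁻¹≈1 , ·e₁ v₁ 0# v₂ v₁⁻¹
  ... | yes v₁≈0 =
    let v₂⁻¹ , v₂v₂⁻¹≈1 = inverse v₂ (λ v₂≈0 → v≢0 (v₁≈0 , v₂≈0))
        det≈ : v₁ * 0# - (- v₂⁻¹) * v₂ ≈ v₂ * v₂⁻¹
        det≈ = solve 3 (λ v₁ v₂ i → v₁ :* con (+ 0) :- (:- i) :* v₂ := v₂ :* i) refl v₁ v₂ v₂⁻¹
    in mat v₁ (- v₂⁻¹) v₂ 0# , trans det≈ v₂v₂⁻¹≈1 , ·e₁ v₁ (- v₂⁻¹) v₂ 0#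

  transport : ∀ {v w} → NonZero v → NonZero w → Σ Mat λ P → Invertible P × (P · v) ≈V w
  transport {v} {w} v≢0 w≢0 with SL-completion v≢0 | SL-completion w≢0
  ... | Bv , det-Bv≈1 , Bve₁≈v | Bw , det-Bw≈1 , Bwe₁≈w = Bw *ₘ adj Bv , P-inv , Pv≈w
    where
    P-inv : Invertible (Bw *ₘ adj Bv)
    P-inv = det≈1⇒Invertible (begin
      det (Bw *ₘ adj Bv)     ≈⟨ det-*ₘ Bw (adj Bv) ⟩
      det Bw * det (adj Bv)  ≈⟨ *-cong det-Bw≈1 (trans (det-adj Bv) det-Bv≈1) ⟩
      1# * 1#                ≈⟨ *-identityˡ 1# ⟩
      1#                     ∎)
      where open ≈-Reasoning
    Pv≈w : ((Bw *ₘ adj Bv) · v) ≈V w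
    Pv≈w = begin
      (Bw *ₘ adj Bv) · v          ≈⟨ *ₘ-· Bw (adj Bv) v ⟩
      Bw · (adj Bv · v)           ≈⟨ ·-cong ≈M.refl (·-cong ≈M.refl Bve₁≈v) ⟨
      Bw · (adj Bv · (Bv · e₁))   ≈⟨ ·-cong ≈M.refl (adj-· Bv e₁ det-Bv≈1) ⟩
      Bw · e₁                     ≈⟨ Bwe₁≈w ⟩
      w                           ∎
      where open ≈V-Reasoning

  sandwich-injective : ∀ {P Q A B} → Invertible P → Invertible Q →
    (P *ₘ (A *ₘ Q)) ≈M (P *ₘ (B *ₘ Q)) → A ≈M B
  sandwich-injective {P} {Q} {A} {B} P-inv Q-inv PAQ≈PBQ =
    agree-on-basis⇒≈M (Invertible-∦ Q-inv e₁∦e₂) (agree-on-Q· e₁) (agree-on-Q· e₂)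
    where
    sandwich-· : ∀ X v → ((P *ₘ (X *ₘ Q)) · v) ≈V (P · (X · (Q · v)))
    sandwich-· X v = ≈V.trans (*ₘ-· P (X *ₘ Q) v) (·-cong ≈M.refl (*ₘ-· X Q v))
    agree-on-Q· : ∀ v → (A · (Q · v)) ≈V (B · (Q · v))
    agree-on-Q· v = Invertible-injective P-inv
      (≈V.trans (≈V.sym (sandwich-· A v)) (≈V.trans (·-cong PAQ≈PBQ ≈V.refl) (sandwich-· B v)))

  -- Cosets

  orient : Bool → Mat → Mat
  orient false M = M
  orient true M = M ᵀ

  orient-involutive : ∀ t M → orient t (orient t M) ≡ M
  orient-involutive false M = ≡.refl
  orient-involutive true M = ≡.refl

  orient-cong : ∀ t {A B} → A ≈M B → orient t A ≈M orient t B
  orient-cong false A≈B = A≈B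
  orient-cong true (p , q , r , s) = p , r , q , s

  orient-injective : ∀ t {A B} → orient t A ≈M orient t B → A ≈M B
  orient-injective false A≈B = A≈B
  orient-injective true (p , q , r , s) = p , r , q , s

  orient-distrib-ₘ : ∀ t A B → orient t (A -ₘ B) ≡ orient t A -ₘ orient t B
  orient-distrib-ₘ false A B = ≡.refl
  orient-distrib-ₘ true A B = ≡.refl

  det-orient : ∀ t M → det (orient t M) ≈ det M
  det-orient false M = refl
  det-orient true M = det-ᵀ M

  -- With transposed = false this is {M | M source = target}, a coset of the stabiliser of a
  -- vector; with true it is {M | Mᵀ source = target}, a coset for the transposed action.
  record Coset : Set where
    constructor coset
    field
      transposed : Bool
      source target : Vec2
      source≢0 : NonZero source
      target≢0 : NonZero target

  open Coset

  infix 4 _∈ᶜ_ _⊆ᶜ_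
  _∈ᶜ_ : Mat → Coset → Set
  M ∈ᶜ C = (orient (transposed C) M · source C) ≈V target C

  _⊆ᶜ_ : List Mat → Coset → Set
  T ⊆ᶜ C = ∀ B → B ∈ T → B ∈ᶜ C

  ∈ᶜ-resp : ∀ C {A B} → A ≈M B → B ∈ᶜ C → A ∈ᶜ C
  ∈ᶜ-resp C A≈B B∈C = ≈V.trans (·-cong (orient-cong (transposed C) A≈B) ≈V.refl) B∈C

  coset-intersecting : ∀ C {A B} → A ∈ᶜ C → B ∈ᶜ C → ∃ λ v → NonZero v × (A · v) ≈V (B · v)
  coset-intersecting C {A} {B} A∈C B∈C = singular-difference⇒agree (begin
    det (A -ₘ B)                    ≈⟨ det-orient t (A -ₘ B) ⟨
    det (orient t (A -ₘ B))         ≡⟨ ≡.cong det (orient-distrib-ₘ t A B) ⟩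
    det (orient t A -ₘ orient t B)  ≈⟨ agree⇒singular-difference (source≢0 C) (≈V.trans A∈C (≈V.sym B∈C)) ⟩
    0#                              ∎)
    where
    t : Bool
    t = transposed C
    open ≈-Reasoning

  module Embedding (C D : Coset) where

    private
      Q-transport : Σ Mat λ Q → Invertible Q × (Q · source D) ≈V source C
      Q-transport = transport (source≢0 D) (source≢0 C)
      P-transport : Σ Mat λ P → Invertible P × (P · target C) ≈V target D
      P-transport = transport (target≢0 C) (target≢0 D)
      Q P : Mat
      Q = proj₁ Q-transport
      P = proj₁ P-transport
      τ : Mat → Mat
      τ = orient (transposed C)

    φ : Mat → Mat
    φ M = orient (transposed D) (P *ₘ (τ M *ₘ Q))

    φ-∈ᶜ : ∀ {M} → M ∈ᶜ C → φ M ∈ᶜ D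
    φ-∈ᶜ {M} M∈C rewrite orient-involutive (transposed D) (P *ₘ (τ M *ₘ Q)) = begin
      (P *ₘ (τ M *ₘ Q)) · source D  ≈⟨ *ₘ-· P (τ M *ₘ Q) (source D) ⟩
      P · ((τ M *ₘ Q) · source D)   ≈⟨ ·-cong ≈M.refl (*ₘ-· (τ M) Q (source D)) ⟩
      P · (τ M · (Q · source D))    ≈⟨ ·-cong ≈M.refl (·-cong ≈M.refl (proj₂ (proj₂ Q-transport))) ⟩
      P · (τ M · source C)          ≈⟨ ·-cong ≈M.refl M∈C ⟩
      P · target C                  ≈⟨ proj₂ (proj₂ P-transport) ⟩
      target D                      ∎
      where open ≈V-Reasoning

    φ-Invertible : ∀ {M} → Invertible M → Invertible (φ M)
    φ-Invertible {M} M-inv det-φM≈0 =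
      x*y≉0 (proj₁ (proj₂ P-transport)) (x*y≉0 τM-inv (proj₁ (proj₂ Q-transport))) (begin
        det P * (det (τ M) * det Q)  ≈⟨ *-congˡ (det-*ₘ (τ M) Q) ⟨
        det P * det (τ M *ₘ Q)       ≈⟨ det-*ₘ P (τ M *ₘ Q) ⟨
        det (P *ₘ (τ M *ₘ Q))        ≈⟨ det-orient (transposed D) _ ⟨
        det (φ M)                    ≈⟨ det-φM≈0 ⟩
        0#                           ∎)
      where
      τM-inv : Invertible (τ M)
      τM-inv det≈0 = M-inv (trans (sym (det-orient (transposed C) M)) det≈0)
      open ≈-Reasoning

    φ-injective : ∀ {A B} → φ A ≈M φ B → A ≈M B
    φ-injective φA≈φB = orient-injective (transposed C)
      (sandwich-injective (proj₁ (proj₂ P-transport)) (proj₁ (proj₂ Q-transport))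
        (orient-injective (transposed D) φA≈φB))

  maximal⇒coset-closed : ∀ {S} C → IsGLSubset S → MaximalIntersecting S → S ⊆ᶜ C →
    ∀ {N} → Invertible N → N ∈ᶜ C → N ∈ S
  maximal⇒coset-closed {S} C (S-inv , S-unique) (_ , S-maximal) S⊆C {N} N-inv N∈C
    with Any.any? (N ≈M?_) S
  ... | yes N∈S = N∈S
  ... | no N∉S = S-maximal (N ∷ S) (N∷S-inv , ¬Any⇒All¬ S N∉S ∷ S-unique) N∷S-intersecting
                   (λ _ → there) N (here ≈M.refl)
    where
    N∷S⊆C : (N ∷ S) ⊆ᶜ C
    N∷S⊆C B (here B≈N) = ∈ᶜ-resp C B≈N N∈C
    N∷S⊆C B (there B∈S) = S⊆C B B∈S
    N∷S-inv : ∀ B → B ∈ (N ∷ S) → Invertible B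
    N∷S-inv B (here B≈N) = Invertible-resp B≈N N-inv
    N∷S-inv B (there B∈S) = S-inv B B∈S
    N∷S-intersecting : Intersecting (N ∷ S)
    N∷S-intersecting A B A∈ B∈ = coset-intersecting C (N∷S⊆C A A∈) (N∷S⊆C B B∈)

  ¬MaximalIntersecting[] : ¬ MaximalIntersecting []
  ¬MaximalIntersecting[] (_ , []-maximal) =
    I∉[] ([]-maximal [ I ] [I]-GL [I]-intersecting (λ _ ()) I (here ≈M.refl))
    where
    I : Mat
    I = mat 1# 0# 0# 1#
    I∉[] : ¬ I ∈ []
    I∉[] ()
    det-I≈1 : det I ≈ 1#
    det-I≈1 = e₁∧e₂≈1
    [I]-GL : IsGLSubset [ I ]
    [I]-GL = (λ { B (here B≈I) → Invertible-resp B≈I (det≈1⇒Invertible det-I≈1) }) , [] ∷ []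
    [I]-intersecting : Intersecting [ I ]
    [I]-intersecting A B (here A≈I) (here B≈I) = e₁ , e₁≢0 , ·-cong (≈M.trans A≈I (≈M.sym B≈I)) ≈V.refl

  -- Intersecting sets lie in cosets

  rank-one-lemma : ∀ {x₁ y₁ x₂ y₂ x₃ y₃} → x₁ ≈V 0ᵥ → y₂ ≈V 0ᵥ → NonZero y₁ →
    x₃ ∥ y₃ → (x₃ -ᵥ x₁) ∥ (y₃ -ᵥ y₁) → (x₃ -ᵥ x₂) ∥ (y₃ -ᵥ y₂) → (x₁ -ᵥ x₂) ∥ (y₁ -ᵥ y₂) →
    x₃ ∥ x₂ × y₃ ∥ x₂
  rank-one-lemma {x₁} {y₁} {x₂} {y₂} {x₃} {y₃} x₁≈0 y₂≈0 y₁≢0 x₃∥y₃ h₃₁ h₃₂ h₁₂ =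
    ∥-trans y₁≢0 (∥-sym x₃∥y₁) (∥-sym x₂∥y₁) , ∥-sym x₂∥y₃
    where
    x₃∥y₁ : x₃ ∥ y₁
    x₃∥y₁ = ∥-subʳ x₃∥y₃ (∥-resp (-ᵥ-identityʳ x₁≈0) ≈V.refl h₃₁)
    x₂∥y₃ : x₂ ∥ y₃
    x₂∥y₃ = ∥-subˡ x₃∥y₃ (∥-resp ≈V.refl (-ᵥ-identityʳ y₂≈0) h₃₂)
    x₂∥y₁ : x₂ ∥ y₁
    x₂∥y₁ = ∥-subˡ (≈0⇒∥ y₁ x₁≈0) (∥-resp ≈V.refl (-ᵥ-identityʳ y₂≈0) h₁₂)

  difference-columns-∥ : ∀ {A B} k l → det (B -ₘ A) ≈ 0# →
    ((B · k) -ᵥ (A · k)) ∥ ((B · l) -ᵥ (A · l))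
  difference-columns-∥ {A} {B} k l det≈0 = ∥-resp (-ₘ-· B A k) (-ₘ-· B A l)
    (trans (det-∧ (B -ₘ A) k l) (trans (*-congʳ det≈0) (zeroˡ _)))

  relative-columns-∥ : ∀ {A B C} k l → det (B -ₘ C) ≈ 0# →
    (((B · k) -ᵥ (A · k)) -ᵥ ((C · k) -ᵥ (A · k))) ∥ (((B · l) -ᵥ (A · l)) -ᵥ ((C · l) -ᵥ (A · l)))
  relative-columns-∥ k l det≈0 =
    ∥-resp (≈V.sym (-ᵥ-cancelʳ _ _ _)) (≈V.sym (-ᵥ-cancelʳ _ _ _)) (difference-columns-∥ k l det≈0)

  image-in-line⇒ᵀ-agree : ∀ {A B k l x} → ¬ k ∥ l →
    ((B · k) -ᵥ (A · k)) ∥ x → ((B · l) -ᵥ (A · l)) ∥ x → (B ᵀ · x ⊥) ≈V (A ᵀ · x ⊥)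
  image-in-line⇒ᵀ-agree {A} {B} {k} {l} {x} k∦l Bk-Ak∥x Bl-Al∥x =
    -ₘ-kernel⇒agree (⟂-basis⇒≈0 k∦l (⟂ k Bk-Ak∥x) (⟂ l Bl-Al∥x))
    where
    ⟂ : ∀ v → ((B · v) -ᵥ (A · v)) ∥ x → ⟨ (B -ₘ A) ᵀ · x ⊥ ∣ v ⟩ ≈ 0#
    ⟂ v Bv-Av∥x = trans (⟨ᵀ·⊥∣⟩≈·∧ (B -ₘ A) x v) (∥-resp (≈V.sym (-ₘ-· B A v)) ≈V.refl Bv-Av∥x)

  point-coset : ∀ {T A₀ v} → Invertible A₀ → NonZero v → (∀ B → B ∈ T → (B · v) ≈V (A₀ · v)) →
    Σ Coset (T ⊆ᶜ_)
  point-coset {A₀ = A₀} {v} A₀-inv v≢0 T-agree =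
    coset false v (A₀ · v) v≢0 (Invertible⇒NonZero A₀-inv v≢0) , T-agree

  module TransposedCoset
    {T A₀ B₁ B₂ k₁ k₂} (T-intersecting : Intersecting T) (A₀-inv : Invertible A₀)
    (A₀∈T : A₀ ∈ T) (B₁∈T : B₁ ∈ T) (B₂∈T : B₂ ∈ T) (k₁≢0 : NonZero k₁) (k₂≢0 : NonZero k₂)
    (B₁k₁≈A₀k₁ : (B₁ · k₁) ≈V (A₀ · k₁)) (B₂k₂≈A₀k₂ : (B₂ · k₂) ≈V (A₀ · k₂))
    (B₁≉A₀ : ¬ B₁ ≈M A₀) (B₂k₁≉A₀k₁ : ¬ (B₂ · k₁) ≈V (A₀ · k₁))
    where

    private
      x y : Mat → Vec2
      x B = (B · k₁) -ᵥ (A₀ · k₁)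
      y B = (B · k₂) -ᵥ (A₀ · k₂)

      singular : ∀ {B C} → B ∈ T → C ∈ T → det (B -ₘ C) ≈ 0#
      singular B∈T C∈T =
        let w , w≢0 , Bw≈Cw = T-intersecting _ _ B∈T C∈T in agree⇒singular-difference w≢0 Bw≈Cw

      k₁∦k₂ : ¬ k₁ ∥ k₂
      k₁∦k₂ k₁∥k₂ = B₂k₁≉A₀k₁ (agree-on-∥ k₂≢0 k₁∥k₂ B₂k₂≈A₀k₂)

      y₁≢0 : NonZero (y B₁)
      y₁≢0 y₁≈0 = B₁≉A₀ (agree-on-basis⇒≈M k₁∦k₂ B₁k₁≈A₀k₁ (-ᵥ≈0⇒≈V y₁≈0))

      x₂⊥≢0 : NonZero (x B₂ ⊥)
      x₂⊥≢0 = ⊥-NonZero (λ x₂≈0 → B₂k₁≉A₀k₁ (-ᵥ≈0⇒≈V x₂≈0))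

      image-in-line : ∀ {B} → B ∈ T → x B ∥ x B₂ × y B ∥ x B₂
      image-in-line B∈T = rank-one-lemma (≈V⇒-ᵥ≈0 B₁k₁≈A₀k₁) (≈V⇒-ᵥ≈0 B₂k₂≈A₀k₂) y₁≢0
        (difference-columns-∥ k₁ k₂ (singular B∈T A₀∈T))
        (relative-columns-∥ k₁ k₂ (singular B∈T B₁∈T))
        (relative-columns-∥ k₁ k₂ (singular B∈T B₂∈T))
        (relative-columns-∥ k₁ k₂ (singular B₁∈T B₂∈T))

    transposed-coset : Σ Coset (T ⊆ᶜ_)
    transposed-coset =
      coset true (x B₂ ⊥) (A₀ ᵀ · x B₂ ⊥) x₂⊥≢0 (Invertible⇒NonZero (Invertible-ᵀ A₀-inv) x₂⊥≢0) ,
      λ B B∈T → let x∥x₂ , y∥x₂ = image-in-line B∈T in image-in-line⇒ᵀ-agree k₁∦k₂ x∥x₂ y∥x₂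

  all-or-counterexample : ∀ {P : Mat → Set} → (∀ M → Dec (P M)) → (∀ {A B} → A ≈M B → P B → P A) →
    ∀ T → (∀ B → B ∈ T → P B) ⊎ (∃ λ B → B ∈ T × ¬ P B)
  all-or-counterexample P? P-resp T with All.all? P? T
  ... | yes all-P = inj₁ (λ B B∈T → All.lookupWith (λ P-C B≈C → P-resp B≈C P-C) all-P B∈T)
  ... | no ¬all-P = inj₂ (find (¬All⇒Any¬ P? T ¬all-P))
    where open import Data.List.Membership.Setoid ≈M-setoid using (find)

  intersecting⇒⊆coset : ∀ {T A₀} → Intersecting T → Invertible A₀ → A₀ ∈ T → Σ Coset (T ⊆ᶜ_)
  intersecting⇒⊆coset {T} {A₀} T-int A₀-inv A₀∈T with all-or-counterexample (_≈M? A₀) ≈M.trans T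
  ... | inj₁ T≈A₀ = point-coset A₀-inv e₁≢0 (λ B B∈T → ·-cong (T≈A₀ B B∈T) ≈V.refl)
  ... | inj₂ (B₁ , B₁∈T , B₁≉A₀) with T-int B₁ A₀ B₁∈T A₀∈T
  ... | k₁ , k₁≢0 , B₁k₁≈A₀k₁
    with all-or-counterexample (λ B → (B · k₁) ≈V? (A₀ · k₁)) (λ A≈B → ≈V.trans (·-cong A≈B ≈V.refl)) T
  ... | inj₁ T-agree = point-coset A₀-inv k₁≢0 T-agree
  ... | inj₂ (B₂ , B₂∈T , B₂k₁≉A₀k₁) with T-int B₂ A₀ B₂∈T A₀∈T
  ... | k₂ , k₂≢0 , B₂k₂≈A₀k₂ = TransposedCoset.transposed-coset T-int A₀-inv A₀∈T B₁∈T B₂∈T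
          k₁≢0 k₂≢0 B₁k₁≈A₀k₁ B₂k₂≈A₀k₂ B₁≉A₀ B₂k₁≉A₀k₁

theorem1p5 : (𝔽 : FiniteField) (S : List (GL.Mat 𝔽)) →
    GL.IsGLSubset 𝔽 S → GL.MaximalIntersecting 𝔽 S → GL.MaximumIntersecting 𝔽 S
theorem1p5 𝔽 [] _ []-maximal = ⊥-elim (¬MaximalIntersecting[] []-maximal)
  where open PlaneGeometry 𝔽
theorem1p5 𝔽 S@(A₀ ∷ _) S-GL S-maximal = proj₁ S-maximal , size≤
  where
  open GL 𝔽
  open PlaneGeometry 𝔽
  S-coset : Σ Coset (S ⊆ᶜ_)
  S-coset = intersecting⇒⊆coset (proj₁ S-maximal) (proj₁ S-GL A₀ (here ≈M.refl)) (here ≈M.refl)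
  size≤ : ∀ T → IsGLSubset T → Intersecting T → size T ≤ size S
  size≤ [] _ _ = z≤n
  size≤ T@(B₀ ∷ _) (T-inv , T-unique) T-int =
    length≤-by-injection ≈M-setoid ≈M-setoid φ φ-injective T-unique φ[T]⊆S
    where
    T-coset : Σ Coset (T ⊆ᶜ_)
    T-coset = intersecting⇒⊆coset T-int (T-inv B₀ (here ≈M.refl)) (here ≈M.refl)
    open Embedding (proj₁ T-coset) (proj₁ S-coset)
    φ[T]⊆S : ∀ {B} → B ∈ T → φ B ∈ S
    φ[T]⊆S {B} B∈T = maximal⇒coset-closed (proj₁ S-coset) S-GL S-maximal (proj₂ S-coset)
      (φ-Invertible (T-inv B B∈T)) (φ-∈ᶜ (proj₂ T-coset B B∈T))
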